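{- Let $p$ be a prime and let $A,B,C,D$ be integers with $0\le C\le A<p$ and $0\le D\le B<p$. Then, modulo $p^2$, $$\binom{Ap+B}{Cp+D}^{ -1}-\binom AC^{ -1}\binom BD^{ -1}\equiv p\binom AC^{ -1}\binom BD^{ -1}\Bigl(C\sum_{i=1}^D\frac1i+(A-C)\sum_{i=1}^{B-D}\frac1i-A\sum_{i=1}^B\frac1i\Bigr).$$
   Context: For rationals $a,b$, $a\equiv b\pmod{p^2}$ means $\nu_p(a-b)\ge2$ (or $a=b$), where $\nu_p$ is the exponent of $p$. Empty sums are $0$. -}

module Defs where

open import Data.Nat as ℕ using (ℕ; zero; suc; _^_)
open import Data.Nat.Divisibility using (_∣_)
open import Data.Integer as ℤ using (+_)
open import Data.Rational using (ℚ; 0ℚ; _+_; _-_; _/_; ↥_; ↧ₙ_)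
open import Data.Product using (_×_)
open import Data.Sum using (_⊎_)
open import Relation.Nullary using (¬_)
open import Relation.Binary.PropositionalEquality using (_≡_)

-- 1/n as a rational; by convention 0 ↦ 0 (only ever applied to positive n
-- in the statement).
invℕ : ℕ → ℚ
invℕ zero    = 0ℚ
invℕ (suc k) = + 1 / suc k

H : ℕ → ℚ
H zero    = 0ℚ
H (suc n) = H n + invℕ (suc n)

-- ν_p(x) ≥ 2 for a nonzero rational x in lowest terms: p² divides the
-- numerator and p does not divide the denominator.
νp≥2 : ℕ → ℚ → Set
νp≥2 p x = (p ^ 2 ∣ ℤ.∣ ↥ x ∣) × ¬ (p ∣ ↧ₙ x)

_≡_[mod_²] : ℚ → ℚ → ℕ → Set
a ≡ b [mod p ²] = (a ≡ b) ⊎ νp≥2 p (a - b)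

module Submission where

-- Work in the ring ℤ₍ₚ₎ of rationals whose denominator is prime to p, modulo p². Since
-- X = (Ap+B choose Cp+D), (A choose C) and (B choose D) are units there, the claim amounts to
--   (A choose C)·(B choose D) ≡ X·(1 + p·E),   E = C·H_D + (A−C)·H_(B−D) − A·H_B.
-- For B = D = 0 this is Babbage's congruence (Ap choose Cp) ≡ (A choose C): the ratio of consecutive
-- terms involves (kp+1)⋯(kp+p−1) ≡ (p−1)!·(1 + kp·H_(p−1)), and p ∣ H_(p−1) because
-- 1/j + 1/(p−j) = p/(j(p−j)).
-- Raising B, and then D, by one multiplies X by (Ap+B+1)/((A−C)p+B+1), resp. ((A−C)p+B−D)/(Cp+D+1), and
-- (B choose D) by (B−D)/(D+1). Each factor (mp+r)/r is exactly 1 + p·m/r, and (1+pu)(1+pv) ≡ 1+p(u+v),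
-- so E moves by the corresponding harmonic increments.

open import Data.Nat.Base using (ℕ)
open import Data.Nat.Primality using (Prime)

module BinomialIdentities where
  open import Data.Nat.Base
  open import Data.Nat.Properties
  open import Data.Nat.Combinatorics
    renaming (_C_ to _choose_)
    using (nCk+nC[k+1]≡[n+1]C[k+1]; k>n⇒nCk≡0; nCk≡nC[n∸k]; nCn≡1; nC1≡n)
  open import Data.Nat.Combinatorics.Base using (_P′_)
  open import Data.Nat.Combinatorics.Specification using (nP′k≡n[n∸1P′k∸1])
  open import Algebra.Properties.CommutativeSemigroup *-commutativeSemigroup using (x∙yz≈y∙xz)
  open import Data.Nat.Tactic.RingSolver using (solve-∀)
  open import Relation.Nullary using (yes; no)
  open import Relation.Binary.PropositionalEquality
  open ≡-Reasoning

  nC0≡1 : ∀ n → n choose 0 ≡ 1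
  nC0≡1 n = trans (nCk≡nC[n∸k] {0} {n} z≤n) (nCn≡1 n)

  nC[k+1]*-congˡ : ∀ n k {x y} → (k < n → x ≡ y) → (n choose suc k) * x ≡ (n choose suc k) * y
  nC[k+1]*-congˡ n k x≡y with k <? n
  ... | yes k<n = cong ((n choose suc k) *_) (x≡y k<n)
  ... | no  k≮n rewrite k>n⇒nCk≡0 (s≤s (≮⇒≥ k≮n)) = refl

  nC[k+1]*[k+1]≡nCk*[n∸k] : ∀ n k → (n choose suc k) * suc k ≡ (n choose k) * (n ∸ k)
  nC[k+1]*[k+1]≡nCk*[n∸k] zero k = begin
    (0 choose suc k) * suc k  ≡⟨ cong (_* suc k) (k>n⇒nCk≡0 {0} {suc k} (s≤s z≤n)) ⟩
    0                         ≡⟨ *-zeroʳ (0 choose k) ⟨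
    (0 choose k) * 0          ≡⟨ cong ((0 choose k) *_) (0∸n≡0 k) ⟨
    (0 choose k) * (0 ∸ k)    ∎
  nC[k+1]*[k+1]≡nCk*[n∸k] (suc n) zero = begin
    (suc n choose 1) * 1      ≡⟨ *-identityʳ (suc n choose 1) ⟩
    suc n choose 1            ≡⟨ nC1≡n (suc n) ⟩
    suc n                     ≡⟨ *-identityˡ (suc n) ⟨
    1 * suc n                 ≡⟨ cong (_* suc n) (nC0≡1 (suc n)) ⟨
    (suc n choose 0) * suc n  ∎
  nC[k+1]*[k+1]≡nCk*[n∸k] (suc n) (suc k) = begin
    (suc n choose (2 + k)) * (2 + k)
      ≡⟨ cong (_* (2 + k)) (nCk+nC[k+1]≡[n+1]C[k+1] n (suc k)) ⟨
    (n choose suc k + n choose (2 + k)) * (2 + k)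
      ≡⟨ *-distribʳ-+ (2 + k) (n choose suc k) _ ⟩
    (n choose suc k) * (2 + k) + (n choose (2 + k)) * (2 + k)
      ≡⟨ cong ((n choose suc k) * (2 + k) +_) (nC[k+1]*[k+1]≡nCk*[n∸k] n (suc k)) ⟩
    (n choose suc k) * (2 + k) + (n choose suc k) * (n ∸ suc k)
      ≡⟨ *-distribˡ-+ (n choose suc k) (2 + k) _ ⟨
    (n choose suc k) * (2 + k + (n ∸ suc k))
      ≡⟨ nC[k+1]*-congˡ n k (λ k<n →
           trans (sym (+-suc (suc k) (n ∸ suc k))) (cong (suc k +_) (sym (+-∸-assoc 1 k<n)))) ⟩
    (n choose suc k) * (suc k + (n ∸ k))
      ≡⟨ *-distribˡ-+ (n choose suc k) (suc k) _ ⟩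
    (n choose suc k) * suc k + (n choose suc k) * (n ∸ k)
      ≡⟨ cong (_+ (n choose suc k) * (n ∸ k)) (nC[k+1]*[k+1]≡nCk*[n∸k] n k) ⟩
    (n choose k) * (n ∸ k) + (n choose suc k) * (n ∸ k)
      ≡⟨ *-distribʳ-+ (n ∸ k) (n choose k) _ ⟨
    (n choose k + n choose suc k) * (n ∸ k)
      ≡⟨ cong (_* (n ∸ k)) (nCk+nC[k+1]≡[n+1]C[k+1] n k) ⟩
    (suc n choose suc k) * (n ∸ k) ∎

  [n+1]Ck*[n+1∸k]≡nCk*[n+1] : ∀ n k → (suc n choose k) * (suc n ∸ k) ≡ (n choose k) * suc n
  [n+1]Ck*[n+1∸k]≡nCk*[n+1] n zero = cong (_* suc n) (trans (nC0≡1 (suc n)) (sym (nC0≡1 n)))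
  [n+1]Ck*[n+1∸k]≡nCk*[n+1] n (suc k) = begin
    (suc n choose suc k) * (n ∸ k)
      ≡⟨ cong (_* (n ∸ k)) (nCk+nC[k+1]≡[n+1]C[k+1] n k) ⟨
    (n choose k + n choose suc k) * (n ∸ k)
      ≡⟨ *-distribʳ-+ (n ∸ k) (n choose k) _ ⟩
    (n choose k) * (n ∸ k) + (n choose suc k) * (n ∸ k)
      ≡⟨ cong (_+ (n choose suc k) * (n ∸ k)) (nC[k+1]*[k+1]≡nCk*[n∸k] n k) ⟨
    (n choose suc k) * suc k + (n choose suc k) * (n ∸ k)
      ≡⟨ *-distribˡ-+ (n choose suc k) (suc k) _ ⟨
    (n choose suc k) * (suc k + (n ∸ k))
      ≡⟨ nC[k+1]*-congˡ n k (λ k<n → cong suc (m+[n∸m]≡n (<⇒≤ k<n))) ⟩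
    (n choose suc k) * suc n ∎

  [m+1]P′[j+1]≡[m+1]*mP′j : ∀ m j → suc m P′ suc j ≡ suc m * (m P′ j)
  [m+1]P′[j+1]≡[m+1]*mP′j m j = nP′k≡n[n∸1P′k∸1] (suc m) (suc j)

  nC[k+j]*[k+j]P′j≡nCk*[n∸k]P′j : ∀ n k j →
    (n choose (k + j)) * ((k + j) P′ j) ≡ (n choose k) * ((n ∸ k) P′ j)
  nC[k+j]*[k+j]P′j≡nCk*[n∸k]P′j n k zero = cong (λ i → (n choose i) * 1) (+-identityʳ k)
  nC[k+j]*[k+j]P′j≡nCk*[n∸k]P′j n k (suc j) rewrite +-suc k j = begin
    (n choose suc (k + j)) * (suc (k + j) P′ suc j)
      ≡⟨ cong ((n choose suc (k + j)) *_) ([m+1]P′[j+1]≡[m+1]*mP′j (k + j) j) ⟩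
    (n choose suc (k + j)) * (suc (k + j) * ((k + j) P′ j))
      ≡⟨ *-assoc (n choose suc (k + j)) _ _ ⟨
    (n choose suc (k + j)) * suc (k + j) * ((k + j) P′ j)
      ≡⟨ cong (_* ((k + j) P′ j)) (nC[k+1]*[k+1]≡nCk*[n∸k] n (k + j)) ⟩
    (n choose (k + j)) * (n ∸ (k + j)) * ((k + j) P′ j)
      ≡⟨ *-assoc (n choose (k + j)) _ _ ⟩
    (n choose (k + j)) * ((n ∸ (k + j)) * ((k + j) P′ j))
      ≡⟨ x∙yz≈y∙xz (n choose (k + j)) (n ∸ (k + j)) _ ⟩
    (n ∸ (k + j)) * ((n choose (k + j)) * ((k + j) P′ j))
      ≡⟨ cong₂ _*_ (sym (∸-+-assoc n k j)) (nC[k+j]*[k+j]P′j≡nCk*[n∸k]P′j n k j) ⟩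
    (n ∸ k ∸ j) * ((n choose k) * ((n ∸ k) P′ j))
      ≡⟨ x∙yz≈y∙xz (n choose k) (n ∸ k ∸ j) _ ⟨
    (n choose k) * ((n ∸ k) P′ suc j) ∎

  [ap+b]∸[cp+d]≡[a∸c]p+[b∸d] : ∀ p {a b c d} → c ≤ a → d ≤ b →
                               (a * p + b) ∸ (c * p + d) ≡ (a ∸ c) * p + (b ∸ d)
  [ap+b]∸[cp+d]≡[a∸c]p+[b∸d] p {a} {b} {c} {d} c≤a d≤b = begin
    (a * p + b) ∸ (c * p + d)
      ≡⟨ cong₂ (λ x y → (x * p + y) ∸ (c * p + d)) (m∸n+n≡m c≤a) (m∸n+n≡m d≤b) ⟨
    ((a ∸ c + c) * p + (b ∸ d + d)) ∸ (c * p + d)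
      ≡⟨ cong (_∸ (c * p + d)) (regroup (a ∸ c) c (b ∸ d) d p) ⟩
    ((a ∸ c) * p + (b ∸ d)) + (c * p + d) ∸ (c * p + d)
      ≡⟨ m+n∸n≡m _ (c * p + d) ⟩
    (a ∸ c) * p + (b ∸ d) ∎
    where
    regroup : ∀ x z y w q → (x + z) * q + (y + w) ≡ (x * q + y) + (z * q + w)
    regroup = solve-∀

  [ap+b+1]C[cp]*[[a∸c]p+b+1]≡[ap+b]C[cp]*[ap+b+1] : ∀ p {a c} b → c ≤ a →
      ((a * p + suc b) choose (c * p)) * ((a ∸ c) * p + suc b)
    ≡ ((a * p + b) choose (c * p)) * (a * p + suc b)
  [ap+b+1]C[cp]*[[a∸c]p+b+1]≡[ap+b]C[cp]*[ap+b+1] p {a} {c} b c≤a = begin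
    ((a * p + suc b) choose (c * p)) * ((a ∸ c) * p + suc b)
      ≡⟨ cong (((a * p + suc b) choose (c * p)) *_) difference ⟨
    ((a * p + suc b) choose (c * p)) * (a * p + suc b ∸ c * p)
      ≡⟨ cong (λ m → (m choose (c * p)) * (m ∸ c * p)) (+-suc (a * p) b) ⟩
    (suc (a * p + b) choose (c * p)) * (suc (a * p + b) ∸ c * p)
      ≡⟨ [n+1]Ck*[n+1∸k]≡nCk*[n+1] (a * p + b) (c * p) ⟩
    ((a * p + b) choose (c * p)) * suc (a * p + b)
      ≡⟨ cong (((a * p + b) choose (c * p)) *_) (+-suc (a * p) b) ⟨
    ((a * p + b) choose (c * p)) * (a * p + suc b) ∎
    where
    difference : a * p + suc b ∸ c * p ≡ (a ∸ c) * p + suc b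
    difference = trans (cong (a * p + suc b ∸_) (sym (+-identityʳ (c * p))))
                       ([ap+b]∸[cp+d]≡[a∸c]p+[b∸d] p c≤a z≤n)

  [ap+b]C[cp+d+1]*[cp+d+1]≡[ap+b]C[cp+d]*[[a∸c]p+[b∸d]] : ∀ p {a b c d} → c ≤ a → d ≤ b →
      ((a * p + b) choose (c * p + suc d)) * (c * p + suc d)
    ≡ ((a * p + b) choose (c * p + d)) * ((a ∸ c) * p + (b ∸ d))
  [ap+b]C[cp+d+1]*[cp+d+1]≡[ap+b]C[cp+d]*[[a∸c]p+[b∸d]] p {a} {b} {c} {d} c≤a d≤b = begin
    ((a * p + b) choose (c * p + suc d)) * (c * p + suc d)
      ≡⟨ cong (λ k → ((a * p + b) choose k) * k) (+-suc (c * p) d) ⟩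
    ((a * p + b) choose suc (c * p + d)) * suc (c * p + d)
      ≡⟨ nC[k+1]*[k+1]≡nCk*[n∸k] (a * p + b) (c * p + d) ⟩
    ((a * p + b) choose (c * p + d)) * (a * p + b ∸ (c * p + d))
      ≡⟨ cong (((a * p + b) choose (c * p + d)) *_) ([ap+b]∸[cp+d]≡[a∸c]p+[b∸d] p c≤a d≤b) ⟩
    ((a * p + b) choose (c * p + d)) * ((a ∸ c) * p + (b ∸ d)) ∎

  [[k+1]p]P′p≡[k+1]p*[kp+q]P′q : ∀ k {p q} → suc q ≡ p → (suc k * p) P′ p ≡ suc k * p * ((k * p + q) P′ q)
  [[k+1]p]P′p≡[k+1]p*[kp+q]P′q k {q = q} refl =
    trans (nP′k≡n[n∸1P′k∸1] (suc k * suc q) (suc q))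
          (cong (λ m → suc k * suc q * (m P′ q)) (+-comm q (k * suc q)))

  [ap]C[[c+1]p]-ratio : ∀ a c {p q} → suc q ≡ p → c < a →
      ((a * p) choose (suc c * p)) * (suc c * ((c * p + q) P′ q))
    ≡ ((a * p) choose (c * p)) * ((a ∸ c) * (((a ∸ suc c) * p + q) P′ q))
  [ap]C[[c+1]p]-ratio a c {q = q} refl c<a = *-cancelʳ-≡ _ _ p (begin
    Y′ * (suc c * R c) * p            ≡⟨ shuffle Y′ (suc c) (R c) p ⟩
    Y′ * (suc c * p * R c)            ≡⟨ cong (Y′ *_) ([[k+1]p]P′p≡[k+1]p*[kp+q]P′q c {q = q} refl) ⟨
    Y′ * ((suc c * p) P′ p)           ≡⟨ cong (λ k → (a * p choose k) * (k P′ p)) (+-comm p (c * p)) ⟩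
    (a * p choose (c * p + p)) * ((c * p + p) P′ p)
                                      ≡⟨ nC[k+j]*[k+j]P′j≡nCk*[n∸k]P′j (a * p) (c * p) p ⟩
    Y * ((a * p ∸ c * p) P′ p)        ≡⟨ cong (λ k → Y * (k P′ p)) (sym (*-distribʳ-∸ p a c)) ⟩
    Y * (((a ∸ c) * p) P′ p)          ≡⟨ cong (λ k → Y * ((k * p) P′ p)) a∸c≡1+m ⟩
    Y * ((suc m * p) P′ p)            ≡⟨ cong (Y *_) ([[k+1]p]P′p≡[k+1]p*[kp+q]P′q m {q = q} refl) ⟩
    Y * (suc m * p * R m)             ≡⟨ cong (λ k → Y * (k * p * R m)) a∸c≡1+m ⟨
    Y * ((a ∸ c) * p * R m)           ≡⟨ shuffle Y (a ∸ c) (R m) p ⟨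
    Y * ((a ∸ c) * R m) * p           ∎)
    where
    p m Y Y′ : ℕ
    p = suc q
    m = a ∸ suc c
    Y = a * p choose (c * p)
    Y′ = a * p choose (suc c * p)
    R : ℕ → ℕ
    R k = (k * p + q) P′ q
    a∸c≡1+m : a ∸ c ≡ suc m
    a∸c≡1+m = +-∸-assoc 1 c<a
    shuffle : ∀ x y z w → x * (y * z) * w ≡ x * (y * w * z)
    shuffle = solve-∀

module Unnormalised where
  open import Defs using (invℕ; H)
  open import Data.Nat.Base as ℕ using (zero; suc; _∸_)
  import Data.Nat.Properties as ℕ
  open import Data.Integer.Base as ℤ using (+_)
  import Data.Integer.Properties as ℤ
  open import Data.Integer.Tactic.RingSolver using (solve-∀)
  import Data.Rational.Base as ℚ
  open import Data.Rational.Properties using (toℚᵘ-homo-+; toℚᵘ-homo-*; toℚᵘ-homo‿-; toℚᵘ-fromℚᵘ)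
  open import Data.Rational.Unnormalised.Base using (ℚᵘ; mkℚᵘ; _≃_; *≡*; _+_; _*_; _-_; _/_; 0ℚᵘ; 1ℚᵘ)
  open import Data.Rational.Unnormalised.Properties
    using (≃-refl; ≃-trans; +-cong; *-cong; *-congˡ; *-congʳ; +-congʳ; -‿cong; *-identityʳ; *-assoc;
           module ≃-Reasoning)
  open import Relation.Binary.PropositionalEquality using (_≡_; sym; trans; cong)

  ι : ℕ → ℚᵘ
  ι n = + n / 1

  invᵘ : ℕ → ℚᵘ
  invᵘ zero    = 0ℚᵘ
  invᵘ (suc n) = + 1 / suc n

  Hᵘ : ℕ → ℚᵘ
  Hᵘ zero    = 0ℚᵘ
  Hᵘ (suc n) = Hᵘ n + invᵘ (suc n)

  ι-+ : ∀ m n → ι (m ℕ.+ n) ≃ ι m + ι n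
  ι-+ m n = *≡* (trans (cong (ℤ._* + 1) (ℤ.pos-+ m n)) (lemma (+ m) (+ n)))
    where
    lemma : ∀ a b → (a ℤ.+ b) ℤ.* + 1 ≡ (a ℤ.* + 1 ℤ.+ b ℤ.* + 1) ℤ.* + 1
    lemma = solve-∀

  ι-* : ∀ m n → ι (m ℕ.* n) ≃ ι m * ι n
  ι-* m n = *≡* (cong (ℤ._* + 1) (ℤ.pos-* m n))

  ι[1+n]*invᵘ[1+n]≃1 : ∀ n → ι (suc n) * invᵘ (suc n) ≃ 1ℚᵘ
  ι[1+n]*invᵘ[1+n]≃1 n = *≡* (trans (ℤ.*-identityʳ (+ suc n ℤ.* + 1)) (trans (ℤ.*-identityʳ (+ suc n))
    (sym (trans (ℤ.*-identityˡ (+ (1 ℕ.* suc n))) (cong +_ (ℕ.*-identityˡ (suc n)))))))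

  harmonicTerm : ℕ → ℕ → ℕ → ℕ → ℚᵘ
  harmonicTerm a b c d = ι c * Hᵘ d + ι (a ∸ c) * Hᵘ (b ∸ d) - ι a * Hᵘ b

  ι[m*[1+s]]*invᵘ[1+s]≃ι[m] : ∀ m s → ι (m ℕ.* suc s) * invᵘ (suc s) ≃ ι m
  ι[m*[1+s]]*invᵘ[1+s]≃ι[m] m s = begin
    ι (m ℕ.* suc s) * invᵘ (suc s)     ≈⟨ *-congʳ {invᵘ (suc s)} (ι-* m (suc s)) ⟩
    ι m * ι (suc s) * invᵘ (suc s)     ≈⟨ *-assoc (ι m) (ι (suc s)) (invᵘ (suc s)) ⟩
    ι m * (ι (suc s) * invᵘ (suc s))   ≈⟨ *-congˡ {ι m} (ι[1+n]*invᵘ[1+n]≃1 s) ⟩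
    ι m * 1ℚᵘ                          ≈⟨ *-identityʳ (ι m) ⟩
    ι m                                ∎
    where open ≃-Reasoning

  toℚᵘ-*-cong : ∀ x y {xᵘ yᵘ} → ℚ.toℚᵘ x ≃ xᵘ → ℚ.toℚᵘ y ≃ yᵘ → ℚ.toℚᵘ (x ℚ.* y) ≃ xᵘ * yᵘ
  toℚᵘ-*-cong x y x≃ y≃ = ≃-trans (toℚᵘ-homo-* x y) (*-cong x≃ y≃)

  toℚᵘ-homo-sub : ∀ x y → ℚ.toℚᵘ (x ℚ.- y) ≃ ℚ.toℚᵘ x - ℚ.toℚᵘ y
  toℚᵘ-homo-sub x y = ≃-trans (toℚᵘ-homo-+ x (ℚ.- y)) (+-congʳ (ℚ.toℚᵘ x) (toℚᵘ-homo‿- y))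

  toℚᵘ-invℕ : ∀ n → ℚ.toℚᵘ (invℕ n) ≃ invᵘ n
  toℚᵘ-invℕ zero    = ≃-refl
  toℚᵘ-invℕ (suc n) = toℚᵘ-fromℚᵘ (mkℚᵘ (+ 1) n)

  toℚᵘ-H : ∀ n → ℚ.toℚᵘ (H n) ≃ Hᵘ n
  toℚᵘ-H zero    = ≃-refl
  toℚᵘ-H (suc n) = ≃-trans (toℚᵘ-homo-+ (H n) (invℕ (suc n))) (+-cong (toℚᵘ-H n) (toℚᵘ-invℕ (suc n)))

  toℚᵘ-[n/1] : ∀ n → ℚ.toℚᵘ (+ n ℚ./ 1) ≃ ι n
  toℚᵘ-[n/1] n = toℚᵘ-fromℚᵘ (mkℚᵘ (+ n) 0)

  toℚᵘ-harmonicTerm : ∀ a b c d →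
    ℚ.toℚᵘ ((+ c ℚ./ 1) ℚ.* H d ℚ.+ (+ (a ∸ c) ℚ./ 1) ℚ.* H (b ∸ d) ℚ.- (+ a ℚ./ 1) ℚ.* H b)
      ≃ harmonicTerm a b c d
  toℚᵘ-harmonicTerm a b c d =
    ≃-trans (toℚᵘ-homo-sub (cH ℚ.+ mH) aH)
            (+-cong (≃-trans (toℚᵘ-homo-+ cH mH) (+-cong (scaled c d) (scaled (a ∸ c) (b ∸ d))))
                    (-‿cong (scaled a b)))
    where
    cH mH aH : ℚ.ℚ
    cH = (+ c ℚ./ 1) ℚ.* H d
    mH = (+ (a ∸ c) ℚ./ 1) ℚ.* H (b ∸ d)
    aH = (+ a ℚ./ 1) ℚ.* H b
    scaled : ∀ m n → ℚ.toℚᵘ ((+ m ℚ./ 1) ℚ.* H n) ≃ ι m * Hᵘ n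
    scaled m n = toℚᵘ-*-cong (+ m ℚ./ 1) (H n) (toℚᵘ-[n/1] m) (toℚᵘ-H n)

  toℚᵘ-[1/X-1/ab]-[p/ab]e : ∀ p X a b e {eᵘ} → ℚ.toℚᵘ e ≃ eᵘ →
    ℚ.toℚᵘ ((invℕ X ℚ.- invℕ a ℚ.* invℕ b) ℚ.- (+ p ℚ./ 1) ℚ.* invℕ a ℚ.* invℕ b ℚ.* e)
      ≃ (invᵘ X - invᵘ a * invᵘ b) - ι p * invᵘ a * invᵘ b * eᵘ
  toℚᵘ-[1/X-1/ab]-[p/ab]e p X a b e e≃eᵘ =
    ≃-trans (toℚᵘ-homo-sub (invℕ X ℚ.- ia ℚ.* ib) (pab ℚ.* e))
            (+-cong (≃-trans (toℚᵘ-homo-sub (invℕ X) (ia ℚ.* ib))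
                             (+-cong (toℚᵘ-invℕ X) (-‿cong (toℚᵘ-*-cong ia ib (toℚᵘ-invℕ a) (toℚᵘ-invℕ b)))))
                    (-‿cong (toℚᵘ-*-cong pab e (toℚᵘ-*-cong (+ p ℚ./ 1 ℚ.* ia) ib
                              (toℚᵘ-*-cong (+ p ℚ./ 1) ia (toℚᵘ-[n/1] p) (toℚᵘ-invℕ a)) (toℚᵘ-invℕ b)) e≃eᵘ)))
    where
    ia ib pab : ℚ.ℚ
    ia = invℕ a
    ib = invℕ b
    pab = (+ p ℚ./ 1) ℚ.* ia ℚ.* ib

module Localisation {p : ℕ} (p-prime : Prime p) where
  open import Data.Nat.Base as ℕ using (zero; suc; _!; _∸_; _^_; _≤_; _<_; z≤n; s≤s; nonTrivial⇒n>1)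
  import Data.Nat.Properties as ℕ
  open import Data.Nat.Combinatorics using () renaming (_C_ to _choose_)
  open import Data.Nat.Combinatorics.Base using (_P′_)
  open import Data.Nat.Combinatorics.Specification using (nP′n≡n!)
  open import Data.Nat.Divisibility
    using (_∣_; divides; ∣-refl; ∣-trans; m∣m*n; ∣⇒≤; 1∣_; _∣0; m*n∣⇒m∣; *-cancelˡ-∣; *-monoʳ-∣)
  open import Data.Nat.Primality using (euclidsLemma; prime⇒nonZero; prime⇒nonTrivial)
  open import Data.Integer.Base as ℤ using (+_)
  import Data.Integer.Properties as ℤ
  open import Data.Rational.Unnormalised.Base
    using (ℚᵘ; mkℚᵘ; ↥_; ↧ₙ_; _≃_; *≡*; _+_; _*_; -_; _-_; 0ℚᵘ; 1ℚᵘ)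
  open import Data.Rational.Unnormalised.Properties
    using (≃-refl; ≃-sym; ≃-trans; ≃-reflexive; +-cong; *-cong; *-congˡ; *-congʳ; +-congˡ; +-congʳ;
           *-zeroʳ; *-identityˡ; *-identityʳ; *-assoc; *-comm; *-distribˡ-+; +-inverseʳ; module ≃-Reasoning;
           +-*-commutativeRing; _≃?_)
  open import Data.Product.Base using (_,_)
  open import Data.Sum.Base using (_⊎_; inj₁; inj₂)
  open import Function.Base using (_∘_)
  open import Level using (0ℓ)
  open import Relation.Binary.Bundles using (Setoid)
  import Relation.Binary.Reasoning.Setoid as SetoidReasoning
  open import Relation.Binary.PropositionalEquality
    using (_≡_; _≢_; refl; sym; trans; cong; subst; module ≡-Reasoning)
  open import Relation.Nullary.Negation using (¬_; contradiction)
  open import Relation.Nullary.Decidable using (yes; no; dec⇒maybe)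
  open import Tactic.RingSolver using (solve-∀)
  open import Tactic.RingSolver.Core.AlmostCommutativeRing using (AlmostCommutativeRing; fromCommutativeRing)
  open import Data.Nat.Coprimality using (recompute)
  import Data.Rational.Base as ℚ
  open import Defs using (νp≥2)
  open BinomialIdentities
  open Unnormalised

  instance
    p≢0 : ℕ.NonZero p
    p≢0 = prime⇒nonZero p-prime

  -- Without a genuine zero test the solver cannot discard coefficients that are merely ≃ 0.
  ℚᵘ-ring : AlmostCommutativeRing 0ℓ 0ℓ
  ℚᵘ-ring = fromCommutativeRing +-*-commutativeRing (λ x → dec⇒maybe (0ℚᵘ ≃? x))

  p∤* : ∀ {m n} → ¬ p ∣ m → ¬ p ∣ n → ¬ p ∣ m ℕ.* n
  p∤* {m} {n} p∤m p∤n p∣mn with euclidsLemma m n p-prime p∣mn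
  ... | inj₁ p∣m = p∤m p∣m
  ... | inj₂ p∣n = p∤n p∣n

  p∤-small : ∀ {n} → 0 < n → n < p → ¬ p ∣ n
  p∤-small {suc n} _ n<p p∣n = ℕ.<⇒≱ n<p (∣⇒≤ p∣n)

  p∤1 : ¬ p ∣ 1
  p∤1 = p∤-small (s≤s z≤n) (nonTrivial⇒n>1 p)
    where instance _ = prime⇒nonTrivial p-prime

  p∤nP′k : ∀ {n} k → k ≤ n → n < p → ¬ p ∣ n P′ k
  p∤nP′k zero _ _ = p∤1
  p∤nP′k {n} (suc k) k<n n<p =
    p∤* (p∤-small (ℕ.m<n⇒0<n∸m k<n) (ℕ.≤-<-trans (ℕ.m∸n≤m n k) n<p)) (p∤nP′k k (ℕ.<⇒≤ k<n) n<p)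

  p∤n! : ∀ {n} → n < p → ¬ p ∣ n !
  p∤n! {n} n<p = subst (¬_ ∘ (p ∣_)) (nP′n≡n! n) (p∤nP′k n ℕ.≤-refl n<p)

  p∤nCk : ∀ {n k} → k ≤ n → n < p → ¬ p ∣ n choose k
  p∤nCk {n} {k} k≤n n<p p∣nCk =
    p∤nP′k k k≤n n<p (subst (p ∣_) nCk*k!≡nP′k (∣-trans p∣nCk (m∣m*n (k P′ k))))
    where
    nCk*k!≡nP′k : (n choose k) ℕ.* (k P′ k) ≡ n P′ k
    nCk*k!≡nP′k = trans (nC[k+j]*[k+j]P′j≡nCk*[n∸k]P′j n 0 k)
                        (trans (cong (ℕ._* (n P′ k)) (nC0≡1 n)) (ℕ.*-identityˡ (n P′ k)))

  p^k∣m*n⇒p^k∣m : ∀ k {m n} → ¬ p ∣ n → p ^ k ∣ m ℕ.* n → p ^ k ∣ m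
  p^k∣m*n⇒p^k∣m zero {m} _ _ = 1∣ m
  p^k∣m*n⇒p^k∣m (suc k) {m} {n} p∤n p^[1+k]∣mn
    with euclidsLemma m n p-prime (m*n∣⇒m∣ p (p ^ k) p^[1+k]∣mn)
  ... | inj₂ p∣n = contradiction p∣n p∤n
  ... | inj₁ (divides m′ refl) =
    subst (p ℕ.* p ^ k ∣_) (ℕ.*-comm p m′) (*-monoʳ-∣ p (p^k∣m*n⇒p^k∣m k p∤n p^k∣m′n))
    where
    p^k∣m′n : p ^ k ∣ m′ ℕ.* n
    p^k∣m′n = *-cancelˡ-∣ p (subst (p ℕ.* p ^ k ∣_) (regroup m′ p n) p^[1+k]∣mn)
      where
      regroup : ∀ a b c → a ℕ.* b ℕ.* c ≡ b ℕ.* (a ℕ.* c)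
      regroup a b c = trans (cong (ℕ._* c) (ℕ.*-comm a b)) (ℕ.*-assoc b a c)

  -- Congruences modulo p² in ℤ₍ₚ₎

  -- Membership of x in ℤ₍ₚ₎, read off the given representative: it is not invariant under ≃.
  record Integral (x : ℚᵘ) : Set where
    constructor integral
    field
      p∤↧x : ¬ p ∣ ↧ₙ x

  Integral-+ : ∀ {x y} → Integral x → Integral y → Integral (x + y)
  Integral-+ {mkℚᵘ _ _} {mkℚᵘ _ _} (integral p∤↧x) (integral p∤↧y) = integral (p∤* p∤↧x p∤↧y)

  Integral-* : ∀ {x y} → Integral x → Integral y → Integral (x * y)
  Integral-* {mkℚᵘ _ _} {mkℚᵘ _ _} (integral p∤↧x) (integral p∤↧y) = integral (p∤* p∤↧x p∤↧y)

  Integral-neg : ∀ {x} → Integral x → Integral (- x)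
  Integral-neg {mkℚᵘ _ _} (integral p∤↧x) = integral p∤↧x

  Integral-ι : ∀ n → Integral (ι n)
  Integral-ι _ = integral p∤1

  Integral-invᵘ : ∀ {n} → ¬ p ∣ n → Integral (invᵘ n)
  Integral-invᵘ {zero}  _   = integral p∤1
  Integral-invᵘ {suc n} p∤n = integral p∤n

  Integral-Hᵘ : ∀ {n} → n < p → Integral (Hᵘ n)
  Integral-Hᵘ {zero}  _   = integral p∤1
  Integral-Hᵘ {suc n} n<p =
    Integral-+ (Integral-Hᵘ (ℕ.<-trans (ℕ.n<1+n n) n<p)) (Integral-invᵘ (p∤-small (s≤s z≤n) n<p))

  infix 4 p^_∣_ _≈_

  -- x ∈ pᵏ·ℤ₍ₚ₎, which is invariant under ≃.
  record p^_∣_ (k : ℕ) (x : ℚᵘ) : Set where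
    constructor multiple
    field
      quotient : ℚᵘ
      quotient-integral : Integral quotient
      equation : x ≃ ι (p ^ k) * quotient

  ∣-resp-≃ : ∀ {k x y} → x ≃ y → p^ k ∣ x → p^ k ∣ y
  ∣-resp-≃ x≃y (multiple z z-int x≃pᵏz) = multiple z z-int (≃-trans (≃-sym x≃y) x≃pᵏz)

  ∣-≃0 : ∀ {k x} → x ≃ 0ℚᵘ → p^ k ∣ x
  ∣-≃0 {k} x≃0 = multiple 0ℚᵘ (Integral-ι 0) (≃-trans x≃0 (≃-sym (*-zeroʳ (ι (p ^ k)))))

  ∣-+ : ∀ {k x y} → p^ k ∣ x → p^ k ∣ y → p^ k ∣ x + y
  ∣-+ {k} (multiple z z-int x≃) (multiple w w-int y≃) =
    multiple (z + w) (Integral-+ z-int w-int) (≃-trans (+-cong x≃ y≃) (≃-sym (*-distribˡ-+ (ι (p ^ k)) z w)))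

  ∣-*ˡ : ∀ {k w x} → Integral w → p^ k ∣ x → p^ k ∣ w * x
  ∣-*ˡ {k} {w} w-int (multiple z z-int x≃) =
    multiple (w * z) (Integral-* w-int z-int) (≃-trans (*-congˡ {w} x≃) (x*[y*z]≃y*[x*z] w (ι (p ^ k)) z))
    where
    x*[y*z]≃y*[x*z] : ∀ a b c → a * (b * c) ≃ b * (a * c)
    x*[y*z]≃y*[x*z] = solve-∀ ℚᵘ-ring

  ∣-weaken : ∀ {k x} → p^ suc k ∣ x → p^ k ∣ x
  ∣-weaken {k} (multiple z z-int x≃) =
    multiple (ι p * z) (Integral-* (Integral-ι p) z-int)
      (≃-trans x≃ (≃-trans (*-congʳ {z} (ι-* p (p ^ k))) (x*y*z≃y*[x*z] (ι p) (ι (p ^ k)) z)))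
    where
    x*y*z≃y*[x*z] : ∀ a b c → a * b * c ≃ b * (a * c)
    x*y*z≃y*[x*z] = solve-∀ ℚᵘ-ring

  ∣-ι[p]* : ∀ {k x} → p^ k ∣ x → p^ suc k ∣ ι p * x
  ∣-ι[p]* {k} (multiple z z-int x≃) =
    multiple z z-int (≃-trans (*-congˡ {ι p} x≃) (≃-trans (≃-sym (*-assoc (ι p) (ι (p ^ k)) z))
                                                           (*-congʳ {z} (≃-sym (ι-* p (p ^ k))))))

  ∣-integral : ∀ {z} → Integral z → p^ 0 ∣ z
  ∣-integral {z} z-int = multiple z z-int (≃-sym (*-identityˡ z))

  ∣⇒∣↥ : ∀ {k x} → p^ k ∣ x → p ^ k ∣ ℤ.∣ ↥ x ∣
  ∣⇒∣↥ {k} {mkℚᵘ n d} (multiple (mkℚᵘ s e) (integral p∤1+e) (*≡* n*1+e≡pᵏs*1+d)) =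
    p^k∣m*n⇒p^k∣m k (subst (¬_ ∘ (p ∣_)) (sym (ℕ.*-identityˡ (suc e))) p∤1+e)
      (divides (ℤ.∣ s ∣ ℕ.* suc d) (begin
        ℤ.∣ n ∣ ℕ.* (1 ℕ.* suc e)          ≡⟨ ℤ.abs-* n (+ (1 ℕ.* suc e)) ⟨
        ℤ.∣ n ℤ.* + (1 ℕ.* suc e) ∣        ≡⟨ cong ℤ.∣_∣ n*1+e≡pᵏs*1+d ⟩
        ℤ.∣ + (p ^ k) ℤ.* s ℤ.* + suc d ∣  ≡⟨ ℤ.abs-* (+ (p ^ k) ℤ.* s) (+ suc d) ⟩
        ℤ.∣ + (p ^ k) ℤ.* s ∣ ℕ.* suc d    ≡⟨ cong (ℕ._* suc d) (ℤ.abs-* (+ (p ^ k)) s) ⟩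
        p ^ k ℕ.* ℤ.∣ s ∣ ℕ.* suc d        ≡⟨ shuffle (p ^ k) ℤ.∣ s ∣ (suc d) ⟩
        ℤ.∣ s ∣ ℕ.* suc d ℕ.* p ^ k        ∎))
    where
    open ≡-Reasoning
    shuffle : ∀ a b c → a ℕ.* b ℕ.* c ≡ b ℕ.* c ℕ.* a
    shuffle a b c = trans (ℕ.*-assoc a b c) (ℕ.*-comm a (b ℕ.* c))

  record _≈_ (x y : ℚᵘ) : Set where
    constructor ≈-intro
    field
      p²∣x-y : p^ 2 ∣ x - y

  ≃⇒≈ : ∀ {x y} → x ≃ y → x ≈ y
  ≃⇒≈ {x} {y} x≃y = ≈-intro (∣-≃0 (≃-trans (+-congˡ (- y) x≃y) (+-inverseʳ y)))

  ≈-refl : ∀ {x} → x ≈ x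
  ≈-refl = ≃⇒≈ ≃-refl

  ≈-sym : ∀ {x y} → x ≈ y → y ≈ x
  ≈-sym {x} {y} (≈-intro x≈y) = ≈-intro (∣-resp-≃ (negate x y) (∣-*ˡ (Integral-neg (Integral-ι 1)) x≈y))
    where
    negate : ∀ a b → - 1ℚᵘ * (a - b) ≃ b - a
    negate = solve-∀ ℚᵘ-ring

  ≈-trans : ∀ {x y z} → x ≈ y → y ≈ z → x ≈ z
  ≈-trans {x} {y} {z} (≈-intro x≈y) (≈-intro y≈z) = ≈-intro (∣-resp-≃ (telescope x y z) (∣-+ x≈y y≈z))
    where
    telescope : ∀ a b c → (a - b) + (b - c) ≃ a - c
    telescope = solve-∀ ℚᵘ-ring

  ≈-setoid : Setoid 0ℓ 0ℓ
  ≈-setoid = record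
    { Carrier = ℚᵘ ; _≈_ = _≈_ ; isEquivalence = record { refl = ≈-refl ; sym = ≈-sym ; trans = ≈-trans } }

  ≈-+ : ∀ {x y u v} → x ≈ y → u ≈ v → x + u ≈ y + v
  ≈-+ {x} {y} {u} {v} (≈-intro x≈y) (≈-intro u≈v) = ≈-intro (∣-resp-≃ (interchange x y u v) (∣-+ x≈y u≈v))
    where
    interchange : ∀ a b c d → (a - b) + (c - d) ≃ (a + c) - (b + d)
    interchange = solve-∀ ℚᵘ-ring

  ≈-*ˡ : ∀ {w x y} → Integral w → x ≈ y → w * x ≈ w * y
  ≈-*ˡ {w} {x} {y} w-int (≈-intro x≈y) = ≈-intro (∣-resp-≃ (*-distribˡ-sub w x y) (∣-*ˡ w-int x≈y))
    where
    *-distribˡ-sub : ∀ a b c → a * (b - c) ≃ a * b - a * c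
    *-distribˡ-sub = solve-∀ ℚᵘ-ring

  ≈-*ʳ : ∀ {w x y} → Integral w → x ≈ y → x * w ≈ y * w
  ≈-*ʳ {w} {x} {y} w-int (≈-intro x≈y) = ≈-intro (∣-resp-≃ (*-distribʳ-sub w x y) (∣-*ˡ w-int x≈y))
    where
    *-distribʳ-sub : ∀ a b c → a * (b - c) ≃ b * a - c * a
    *-distribʳ-sub = solve-∀ ℚᵘ-ring

  ≈-*-cancelʳ : ∀ {n x y} → ¬ p ∣ n → x * ι n ≈ y * ι n → x ≈ y
  ≈-*-cancelʳ {zero} p∤0 _ = contradiction (p ∣0) p∤0
  ≈-*-cancelʳ {suc n} {x} {y} p∤n x·n≈y·n = begin
    x                               ≈⟨ ≃⇒≈ (cancel x) ⟨
    x * ι (suc n) * invᵘ (suc n)    ≈⟨ ≈-*ʳ (Integral-invᵘ p∤n) x·n≈y·n ⟩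
    y * ι (suc n) * invᵘ (suc n)    ≈⟨ ≃⇒≈ (cancel y) ⟩
    y                               ∎
    where
    open SetoidReasoning ≈-setoid
    cancel : ∀ z → z * ι (suc n) * invᵘ (suc n) ≃ z
    cancel z = ≃-trans (*-assoc z (ι (suc n)) (invᵘ (suc n)))
                       (≃-trans (*-congˡ {z} (ι[1+n]*invᵘ[1+n]≃1 n)) (*-identityʳ z))

  -- Principal units 1 + p·e

  1+p·_ : ℚᵘ → ℚᵘ
  1+p· e = 1ℚᵘ + ι p * e

  Integral-1+p· : ∀ {e} → Integral e → Integral (1+p· e)
  Integral-1+p· e-int = Integral-+ (Integral-ι 1) (Integral-* (Integral-ι p) e-int)

  ι-p² : ι (p ^ 2) ≃ ι p * ι p
  ι-p² = ≃-trans (ι-* p (p ^ 1)) (*-congˡ {ι p} (≃-reflexive (cong ι (ℕ.*-identityʳ p))))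

  1+p·-* : ∀ {u v} → Integral u → Integral v → (1+p· u) * (1+p· v) ≈ 1+p· (u + v)
  1+p·-* {u} {v} u-int v-int =
    ≈-intro (multiple (u * v) (Integral-* u-int v-int)
                      (≃-trans (expand (ι p) u v) (*-congʳ {u * v} (≃-sym ι-p²))))
    where
    expand : ∀ P a b → (1ℚᵘ + P * a) * (1ℚᵘ + P * b) - (1ℚᵘ + P * (a + b)) ≃ P * P * (a * b)
    expand = solve-∀ ℚᵘ-ring

  ι[mp+1+r]≃ι[1+r]*1+p·m/[1+r] : ∀ m r → ι (m ℕ.* p ℕ.+ suc r) ≃ ι (suc r) * 1+p· (ι m * invᵘ (suc r))
  ι[mp+1+r]≃ι[1+r]*1+p·m/[1+r] m r = begin
    ι (m ℕ.* p ℕ.+ suc r)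
      ≈⟨ ≃-trans (ι-+ (m ℕ.* p) (suc r)) (+-congˡ (ι (suc r)) (ι-* m p)) ⟩
    ι m * ι p + ι (suc r)
      ≈⟨ +-congˡ (ι (suc r)) (≃-sym (*-identityʳ (ι m * ι p))) ⟩
    ι m * ι p * 1ℚᵘ + ι (suc r)
      ≈⟨ +-congˡ (ι (suc r)) (*-congˡ {ι m * ι p} (≃-sym (ι[1+n]*invᵘ[1+n]≃1 r))) ⟩
    ι m * ι p * (ι (suc r) * invᵘ (suc r)) + ι (suc r)
      ≈⟨ regroup (ι m) (ι p) (ι (suc r)) (invᵘ (suc r)) ⟩
    ι (suc r) * 1+p· (ι m * invᵘ (suc r)) ∎
    where
    open ≃-Reasoning
    regroup : ∀ a P s i → a * P * (s * i) + s ≃ s * (1ℚᵘ + P * (a * i))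
    regroup = solve-∀ ℚᵘ-ring

  1+p·-cong : ∀ {a b} → a ≃ b → 1+p· a ≃ 1+p· b
  1+p·-cong a≃b = +-congʳ 1ℚᵘ (*-congˡ {ι p} a≃b)

  ≈-shift : ∀ {c x y e u v} → Integral x → Integral y → Integral e → Integral u → Integral v →
            y * 1+p· v ≃ x * 1+p· u → c ≈ x * 1+p· e → c ≈ y * 1+p· (e + v - u)
  ≈-shift {c} {x} {y} {e} {u} {v} x-int y-int e-int u-int v-int y·v≃x·u c≈x·e = begin
    c
      ≈⟨ c≈x·e ⟩
    x * 1+p· e
      ≈⟨ ≈-*ˡ x-int (≈-trans (1+p·-* u-int e-u-int) (≃⇒≈ (1+p·-cong (a+[b-a]≃b u e)))) ⟨
    x * (1+p· u * 1+p· (e - u))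
      ≈⟨ ≃⇒≈ (≃-sym (*-assoc x (1+p· u) (1+p· (e - u)))) ⟩
    x * 1+p· u * 1+p· (e - u)
      ≈⟨ ≃⇒≈ (*-congʳ {1+p· (e - u)} y·v≃x·u) ⟨
    y * 1+p· v * 1+p· (e - u)
      ≈⟨ ≃⇒≈ (*-assoc y (1+p· v) (1+p· (e - u))) ⟩
    y * (1+p· v * 1+p· (e - u))
      ≈⟨ ≈-*ˡ y-int (≈-trans (1+p·-* v-int e-u-int) (≃⇒≈ (1+p·-cong (c+[a-b]≃a+c-b v e u)))) ⟩
    y * 1+p· (e + v - u) ∎
    where
    open SetoidReasoning ≈-setoid
    e-u-int : Integral (e - u)
    e-u-int = Integral-+ e-int (Integral-neg u-int)
    a+[b-a]≃b : ∀ a b → a + (b - a) ≃ b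
    a+[b-a]≃b = solve-∀ ℚᵘ-ring
    c+[a-b]≃a+c-b : ∀ c a b → c + (a - b) ≃ a + c - b
    c+[a-b]≃a+c-b = solve-∀ ℚᵘ-ring

  1+p·m/[1+r]≃ι[mp+1+r]/[1+r] : ∀ m r → 1+p· (ι m * invᵘ (suc r)) ≃ ι (m ℕ.* p ℕ.+ suc r) * invᵘ (suc r)
  1+p·m/[1+r]≃ι[mp+1+r]/[1+r] m r = begin
    U                            ≈⟨ *-identityˡ U ⟨
    1ℚᵘ * U                      ≈⟨ *-congʳ {U} (ι[1+n]*invᵘ[1+n]≃1 r) ⟨
    ι (suc r) * invᵘ (suc r) * U ≈⟨ swap (ι (suc r)) (invᵘ (suc r)) U ⟩
    ι (suc r) * U * invᵘ (suc r) ≈⟨ *-congʳ {invᵘ (suc r)} (ι[mp+1+r]≃ι[1+r]*1+p·m/[1+r] m r) ⟨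
    ι (m ℕ.* p ℕ.+ suc r) * invᵘ (suc r) ∎
    where
    open ≃-Reasoning
    U : ℚᵘ
    U = 1+p· (ι m * invᵘ (suc r))
    swap : ∀ a b c → a * b * c ≃ a * c * b
    swap = solve-∀ ℚᵘ-ring

  ≈-step : ∀ {X X′ m m′ s t c e} → suc s < p → suc t < p → Integral e →
           X′ ℕ.* (m′ ℕ.* p ℕ.+ suc s) ≡ X ℕ.* (m ℕ.* p ℕ.+ suc t) →
           c ≈ ι X * 1+p· e →
           c * (ι (suc t) * invᵘ (suc s)) ≈ ι X′ * 1+p· (e + ι m′ * invᵘ (suc s) - ι m * invᵘ (suc t))
  ≈-step {X} {X′} {m} {m′} {s} {t} {c} {e} s<p t<p e-int X′-eq c≈X·e =
    ≈-shift (Integral-* (Integral-ι X) r-int) (Integral-ι X′) e-int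
            (Integral-* (Integral-ι m) it-int) (Integral-* (Integral-ι m′) is-int) ratio
            (≈-trans (≈-*ʳ r-int c≈X·e) (≃⇒≈ (swap (ι X) (1+p· e) r)))
    where
    is it r : ℚᵘ
    is = invᵘ (suc s)
    it = invᵘ (suc t)
    r = ι (suc t) * is
    is-int : Integral is
    is-int = Integral-invᵘ (p∤-small (s≤s z≤n) s<p)
    it-int : Integral it
    it-int = Integral-invᵘ (p∤-small (s≤s z≤n) t<p)
    r-int : Integral r
    r-int = Integral-* (Integral-ι (suc t)) is-int
    swap : ∀ a b c → a * b * c ≃ a * c * b
    swap = solve-∀ ℚᵘ-ring
    regroup : ∀ x t u i → x * (t * u) * i ≃ x * (t * i) * u
    regroup = solve-∀ ℚᵘ-ring
    ratio : ι X′ * 1+p· (ι m′ * is) ≃ ι X * r * 1+p· (ι m * it)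
    ratio = begin
      ι X′ * 1+p· (ι m′ * is)
        ≈⟨ *-congˡ {ι X′} (1+p·m/[1+r]≃ι[mp+1+r]/[1+r] m′ s) ⟩
      ι X′ * (ι (m′ ℕ.* p ℕ.+ suc s) * is)
        ≈⟨ *-assoc (ι X′) (ι (m′ ℕ.* p ℕ.+ suc s)) is ⟨
      ι X′ * ι (m′ ℕ.* p ℕ.+ suc s) * is
        ≈⟨ *-congʳ {is} (ι-* X′ _) ⟨
      ι (X′ ℕ.* (m′ ℕ.* p ℕ.+ suc s)) * is
        ≈⟨ *-congʳ {is} (≃-reflexive (cong ι X′-eq)) ⟩
      ι (X ℕ.* (m ℕ.* p ℕ.+ suc t)) * is
        ≈⟨ *-congʳ {is} (ι-* X _) ⟩
      ι X * ι (m ℕ.* p ℕ.+ suc t) * is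
        ≈⟨ *-congʳ {is} (*-congˡ {ι X} (ι[mp+1+r]≃ι[1+r]*1+p·m/[1+r] m t)) ⟩
      ι X * (ι (suc t) * 1+p· (ι m * it)) * is
        ≈⟨ regroup (ι X) (ι (suc t)) (1+p· (ι m * it)) is ⟩
      ι X * r * 1+p· (ι m * it) ∎
      where open ≃-Reasoning

  -- Babbage's congruence

  ι[kp+n]P′n≈n!*1+p·kHn : ∀ k n → n < p → ι ((k ℕ.* p ℕ.+ n) P′ n) ≈ ι (n !) * 1+p· (ι k * Hᵘ n)
  ι[kp+n]P′n≈n!*1+p·kHn k zero _ = ≃⇒≈ (≃-sym (one≃ (ι p) (ι k)))
    where
    one≃ : ∀ P a → 1ℚᵘ * (1ℚᵘ + P * (a * 0ℚᵘ)) ≃ 1ℚᵘ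
    one≃ = solve-∀ ℚᵘ-ring
  ι[kp+n]P′n≈n!*1+p·kHn k (suc n) 1+n<p = begin
    ι ((k ℕ.* p ℕ.+ suc n) P′ suc n)
      ≡⟨ cong ι unfold ⟩
    ι ((k ℕ.* p ℕ.+ suc n) ℕ.* ((k ℕ.* p ℕ.+ n) P′ n))
      ≈⟨ ≃⇒≈ (ι-* (k ℕ.* p ℕ.+ suc n) ((k ℕ.* p ℕ.+ n) P′ n)) ⟩
    ι (k ℕ.* p ℕ.+ suc n) * ι ((k ℕ.* p ℕ.+ n) P′ n)
      ≈⟨ ≈-*ˡ (Integral-ι (k ℕ.* p ℕ.+ suc n)) (ι[kp+n]P′n≈n!*1+p·kHn k n n<p) ⟩
    ι (k ℕ.* p ℕ.+ suc n) * (ι (n !) * 1+p· (ι k * Hᵘ n))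
      ≈⟨ ≃⇒≈ (*-congʳ {ι (n !) * 1+p· (ι k * Hᵘ n)} (ι[mp+1+r]≃ι[1+r]*1+p·m/[1+r] k n)) ⟩
    ι (suc n) * 1+p· (ι k * i) * (ι (n !) * 1+p· (ι k * Hᵘ n))
      ≈⟨ ≃⇒≈ (regroup (ι (suc n)) (1+p· (ι k * i)) (ι (n !)) (1+p· (ι k * Hᵘ n))) ⟩
    ι (suc n) * ι (n !) * (1+p· (ι k * i) * 1+p· (ι k * Hᵘ n))
      ≈⟨ ≈-*ˡ (Integral-* (Integral-ι (suc n)) (Integral-ι (n !)))
              (1+p·-* (Integral-* (Integral-ι k) i-int) (Integral-* (Integral-ι k) (Integral-Hᵘ n<p))) ⟩
    ι (suc n) * ι (n !) * 1+p· (ι k * i + ι k * Hᵘ n)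
      ≈⟨ ≃⇒≈ (*-cong (≃-sym (ι-* (suc n) (n !))) (1+p·-cong (distrib (ι k) i (Hᵘ n)))) ⟩
    ι (suc n !) * 1+p· (ι k * Hᵘ (suc n)) ∎
    where
    open SetoidReasoning ≈-setoid
    n<p : n < p
    n<p = ℕ.<-trans (ℕ.n<1+n n) 1+n<p
    i : ℚᵘ
    i = invᵘ (suc n)
    i-int : Integral i
    i-int = Integral-invᵘ (p∤-small (s≤s z≤n) 1+n<p)
    unfold : (k ℕ.* p ℕ.+ suc n) P′ suc n ≡ (k ℕ.* p ℕ.+ suc n) ℕ.* ((k ℕ.* p ℕ.+ n) P′ n)
    unfold rewrite ℕ.+-suc (k ℕ.* p) n = [m+1]P′[j+1]≡[m+1]*mP′j (k ℕ.* p ℕ.+ n) n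
    regroup : ∀ s u f v → s * u * (f * v) ≃ s * f * (u * v)
    regroup = solve-∀ ℚᵘ-ring
    distrib : ∀ a b c → a * b + a * c ≃ a * (c + b)
    distrib = solve-∀ ℚᵘ-ring

  invᵘ-pair : ∀ s t → suc s ℕ.+ suc t ≡ p → invᵘ (suc s) + invᵘ (suc t) ≃ ι p * (invᵘ (suc s) * invᵘ (suc t))
  invᵘ-pair s t s+t≡p = begin
    i + j
      ≈⟨ +-cong (*-identityˡ i) (*-identityˡ j) ⟨
    1ℚᵘ * i + 1ℚᵘ * j
      ≈⟨ +-cong (*-congʳ {i} (ι[1+n]*invᵘ[1+n]≃1 t)) (*-congʳ {j} (ι[1+n]*invᵘ[1+n]≃1 s)) ⟨
    ι (suc t) * j * i + ι (suc s) * i * j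
      ≈⟨ regroup (ι (suc s)) (ι (suc t)) i j ⟩
    (ι (suc s) + ι (suc t)) * (i * j)
      ≈⟨ *-congʳ {i * j} (≃-trans (≃-sym (ι-+ (suc s) (suc t))) (≃-reflexive (cong ι s+t≡p))) ⟩
    ι p * (i * j) ∎
    where
    open ≃-Reasoning
    i j : ℚᵘ
    i = invᵘ (suc s)
    j = invᵘ (suc t)
    regroup : ∀ a b x y → b * y * x + a * x * y ≃ (a + b) * (x * y)
    regroup = solve-∀ ℚᵘ-ring

  p-1 : ℕ
  p-1 = ℕ.pred p

  1+[p-1]≡p : suc p-1 ≡ p
  1+[p-1]≡p = ℕ.suc-pred p

  p∣1/s+1/t : ∀ s t → suc s ℕ.+ suc t ≡ p → p^ 1 ∣ invᵘ (suc s) + invᵘ (suc t)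
  p∣1/s+1/t s t s+t≡p =
    ∣-resp-≃ (≃-sym (invᵘ-pair s t s+t≡p))
             (∣-ι[p]* (∣-integral (Integral-* (Integral-invᵘ (p∤-small (s≤s z≤n) 1+s<p))
                                              (Integral-invᵘ (p∤-small (s≤s z≤n) 1+t<p)))))
    where
    1+s<p : suc s < p
    1+s<p = subst (suc s <_) s+t≡p (ℕ.m<m+n (suc s) (s≤s z≤n))
    1+t<p : suc t < p
    1+t<p = subst (suc t <_) s+t≡p (ℕ.m<n+m (suc t) (s≤s z≤n))

  p∣Hᵘ[p-1] : p ≢ 2 → p^ 1 ∣ Hᵘ p-1
  p∣Hᵘ[p-1] p≢2 =
    ∣-resp-≃ halve (∣-*ˡ (Integral-invᵘ p∤2) (subst (λ k → p^ 1 ∣ Hᵘ p-1 + (Hᵘ p-1 - Hᵘ k))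
                                                   (ℕ.n∸n≡0 p-1) (p∣H[j]+H[p-1]-H[p-1-j] p-1 ℕ.≤-refl)))
    where
    p∤2 : ¬ p ∣ 2
    p∤2 p∣2 = p≢2 (ℕ.≤-antisym (∣⇒≤ p∣2) (nonTrivial⇒n>1 p))
      where instance _ = prime⇒nonTrivial p-prime
    halve : invᵘ 2 * (Hᵘ p-1 + (Hᵘ p-1 - 0ℚᵘ)) ≃ Hᵘ p-1
    halve = ≃-trans (twice (invᵘ 2) (Hᵘ p-1))
                    (≃-trans (*-congʳ {Hᵘ p-1} (≃-trans (*-comm (invᵘ 2) (ι 2)) (ι[1+n]*invᵘ[1+n]≃1 1)))
                             (*-identityˡ (Hᵘ p-1)))
      where
      twice : ∀ i h → i * (h + (h - 0ℚᵘ)) ≃ i * (1ℚᵘ + 1ℚᵘ) * h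
      twice = solve-∀ ℚᵘ-ring
    p∣H[j]+H[p-1]-H[p-1-j] : ∀ j → j ≤ p-1 → p^ 1 ∣ Hᵘ j + (Hᵘ p-1 - Hᵘ (p-1 ∸ j))
    p∣H[j]+H[p-1]-H[p-1-j] zero _ = ∣-≃0 (zero+[h-h]≃0 (Hᵘ p-1))
      where
      zero+[h-h]≃0 : ∀ h → 0ℚᵘ + (h - h) ≃ 0ℚᵘ
      zero+[h-h]≃0 = solve-∀ ℚᵘ-ring
    p∣H[j]+H[p-1]-H[p-1-j] (suc j) 1+j≤p-1 =
      ∣-resp-≃ (telescope (Hᵘ j) (Hᵘ p-1) (Hᵘ r) (invᵘ (suc j)) (invᵘ (suc r)))
               (∣-+ (subst (λ k → p^ 1 ∣ Hᵘ j + (Hᵘ p-1 - Hᵘ k)) p-1∸j≡1+r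
                           (p∣H[j]+H[p-1]-H[p-1-j] j (ℕ.<⇒≤ 1+j≤p-1)))
                    (p∣1/s+1/t j r 1+j+1+r≡p))
      where
      r : ℕ
      r = p-1 ∸ suc j
      p-1∸j≡1+r : p-1 ∸ j ≡ suc r
      p-1∸j≡1+r = ℕ.+-∸-assoc 1 1+j≤p-1
      1+j+1+r≡p : suc j ℕ.+ suc r ≡ p
      1+j+1+r≡p = trans (cong (suc j ℕ.+_) (sym p-1∸j≡1+r))
                        (trans (cong suc (ℕ.m+[n∸m]≡n (ℕ.<⇒≤ 1+j≤p-1))) 1+[p-1]≡p)
      telescope : ∀ a q b x y → a + (q - (b + y)) + (x + y) ≃ a + x + (q - b)
      telescope = solve-∀ ℚᵘ-ring

  1+p·kH[p-1]≈1 : ∀ k → k ≡ 0 ⊎ p ≢ 2 → 1+p· (ι k * Hᵘ p-1) ≈ 1ℚᵘ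
  1+p·kH[p-1]≈1 .0 (inj₁ refl) = ≃⇒≈ (1+P[0h]≃1 (ι p) (Hᵘ p-1))
    where
    1+P[0h]≃1 : ∀ P h → 1ℚᵘ + P * (0ℚᵘ * h) ≃ 1ℚᵘ
    1+P[0h]≃1 = solve-∀ ℚᵘ-ring
  1+p·kH[p-1]≈1 k (inj₂ p≢2) =
    ≈-intro (∣-resp-≃ (≃-sym (1+x-1≃x (ι p * (ι k * Hᵘ p-1))))
                      (∣-ι[p]* (∣-*ˡ (Integral-ι k) (p∣Hᵘ[p-1] p≢2))))
    where
    1+x-1≃x : ∀ x → 1ℚᵘ + x - 1ℚᵘ ≃ x
    1+x-1≃x = solve-∀ ℚᵘ-ring

  p-1<p : p-1 < p
  p-1<p = subst (p-1 <_) 1+[p-1]≡p (ℕ.n<1+n p-1)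

  ι[kp+p-1]P′[p-1]≈[p-1]! : ∀ k → k ≡ 0 ⊎ p ≢ 2 → ι ((k ℕ.* p ℕ.+ p-1) P′ p-1) ≈ ι (p-1 !)
  ι[kp+p-1]P′[p-1]≈[p-1]! k k≡0⊎p≢2 = begin
    ι ((k ℕ.* p ℕ.+ p-1) P′ p-1)            ≈⟨ ι[kp+n]P′n≈n!*1+p·kHn k p-1 p-1<p ⟩
    ι (p-1 !) * 1+p· (ι k * Hᵘ p-1)         ≈⟨ ≈-*ˡ (Integral-ι (p-1 !)) (1+p·kH[p-1]≈1 k k≡0⊎p≢2) ⟩
    ι (p-1 !) * 1ℚᵘ                         ≈⟨ ≃⇒≈ (*-identityʳ (ι (p-1 !))) ⟩
    ι (p-1 !)                               ∎
    where open SetoidReasoning ≈-setoid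

  -- p ∣ H (p - 1) fails for p = 2, but then a < p leaves only k = 0.
  small-or-odd : ∀ {k a} → k < a → a < p → k ≡ 0 ⊎ p ≢ 2
  small-or-odd {k} k<a a<p with p ℕ.≟ 2
  ... | yes refl = inj₁ (ℕ.n<1⇒n≡0 (ℕ.<-≤-trans k<a (ℕ.≤-pred a<p)))
  ... | no  p≢2  = inj₂ p≢2

  ι[ap]C[cp]≈aCc : ∀ a c → c ≤ a → a < p → ι (a ℕ.* p choose c ℕ.* p) ≈ ι (a choose c)
  ι[ap]C[cp]≈aCc a zero _ _ = ≃⇒≈ (≃-reflexive (cong ι (trans (nC0≡1 (a ℕ.* p)) (sym (nC0≡1 a)))))
  ι[ap]C[cp]≈aCc a (suc c) c<a a<p =
    ≈-*-cancelʳ (p∤* (p∤-small (s≤s z≤n) (ℕ.≤-<-trans c<a a<p)) (p∤n! p-1<p)) (begin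
      ι Y′ * ι (suc c ℕ.* F)
        ≈⟨ ≈-*ˡ (Integral-ι Y′) (ι[s*R]≈ι[s*F] (suc c) c (small-or-odd c<a a<p)) ⟨
      ι Y′ * ι (suc c ℕ.* R c)
        ≈⟨ ≃⇒≈ (ι-* Y′ (suc c ℕ.* R c)) ⟨
      ι (Y′ ℕ.* (suc c ℕ.* R c))
        ≡⟨ cong ι ([ap]C[[c+1]p]-ratio a c 1+[p-1]≡p c<a) ⟩
      ι (Y ℕ.* ((a ∸ c) ℕ.* R m))
        ≈⟨ ≃⇒≈ (ι-* Y ((a ∸ c) ℕ.* R m)) ⟩
      ι Y * ι ((a ∸ c) ℕ.* R m)
        ≈⟨ ≈-*ˡ (Integral-ι Y) (ι[s*R]≈ι[s*F] (a ∸ c) m (small-or-odd m<a a<p)) ⟩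
      ι Y * ι ((a ∸ c) ℕ.* F)
        ≈⟨ ≈-*ʳ (Integral-ι _) (ι[ap]C[cp]≈aCc a c (ℕ.<⇒≤ c<a) a<p) ⟩
      ι A * ι ((a ∸ c) ℕ.* F)
        ≈⟨ ≃⇒≈ (ι-* A ((a ∸ c) ℕ.* F)) ⟨
      ι (A ℕ.* ((a ∸ c) ℕ.* F))
        ≡⟨ cong ι absorb ⟩
      ι (A′ ℕ.* (suc c ℕ.* F))
        ≈⟨ ≃⇒≈ (ι-* A′ (suc c ℕ.* F)) ⟩
      ι A′ * ι (suc c ℕ.* F) ∎)
    where
    open SetoidReasoning ≈-setoid
    Y′ Y A′ A F m : ℕ
    Y′ = a ℕ.* p choose suc c ℕ.* p
    Y = a ℕ.* p choose c ℕ.* p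
    A′ = a choose suc c
    A = a choose c
    F = p-1 !
    m = a ∸ suc c
    R : ℕ → ℕ
    R k = (k ℕ.* p ℕ.+ p-1) P′ p-1
    m<a : m < a
    m<a = subst (_≤ a) (ℕ.+-∸-assoc 1 c<a) (ℕ.m∸n≤m a c)
    ι[s*R]≈ι[s*F] : ∀ s k → k ≡ 0 ⊎ p ≢ 2 → ι (s ℕ.* R k) ≈ ι (s ℕ.* F)
    ι[s*R]≈ι[s*F] s k k≡0⊎p≢2 = begin
      ι (s ℕ.* R k)   ≈⟨ ≃⇒≈ (ι-* s (R k)) ⟩
      ι s * ι (R k)   ≈⟨ ≈-*ˡ (Integral-ι s) (ι[kp+p-1]P′[p-1]≈[p-1]! k k≡0⊎p≢2) ⟩
      ι s * ι F       ≈⟨ ≃⇒≈ (ι-* s F) ⟨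
      ι (s ℕ.* F)     ∎
    absorb : A ℕ.* ((a ∸ c) ℕ.* F) ≡ A′ ℕ.* (suc c ℕ.* F)
    absorb = trans (sym (ℕ.*-assoc A (a ∸ c) F))
                   (trans (cong (ℕ._* F) (sym (nC[k+1]*[k+1]≡nCk*[n∸k] a c))) (ℕ.*-assoc A′ (suc c) F))

  -- Expansion of (ap+b choose cp+d) and of its inverse

  Integral-harmonicTerm : ∀ a {b} c {d} → d ≤ b → b < p → Integral (harmonicTerm a b c d)
  Integral-harmonicTerm a {b} c {d} d≤b b<p =
    Integral-+ (Integral-+ (Integral-* (Integral-ι c) (Integral-Hᵘ (ℕ.≤-<-trans d≤b b<p)))
                           (Integral-* (Integral-ι (a ∸ c)) (Integral-Hᵘ (ℕ.≤-<-trans (ℕ.m∸n≤m b d) b<p))))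
               (Integral-neg (Integral-* (Integral-ι a) (Integral-Hᵘ b<p)))

  expansion-d≡0 : ∀ a b c → c ≤ a → a < p → b < p →
    ι (a choose c) ≈ ι ((a ℕ.* p ℕ.+ b) choose (c ℕ.* p)) * 1+p· harmonicTerm a b c 0
  expansion-d≡0 a zero c c≤a a<p _ = begin
    ι (a choose c)                      ≈⟨ ι[ap]C[cp]≈aCc a c c≤a a<p ⟨
    ι (a ℕ.* p choose c ℕ.* p)          ≡⟨ cong (λ n → ι (n choose c ℕ.* p)) (ℕ.+-identityʳ (a ℕ.* p)) ⟨
    ι X                                 ≈⟨ ≃⇒≈ (x≃x*1+P[c0+m0-a0] (ι X) (ι p) (ι c) (ι (a ∸ c)) (ι a)) ⟩
    ι X * 1+p· harmonicTerm a 0 c 0     ∎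
    where
    open SetoidReasoning ≈-setoid
    X : ℕ
    X = (a ℕ.* p ℕ.+ 0) choose (c ℕ.* p)
    x≃x*1+P[c0+m0-a0] : ∀ x P c m a → x ≃ x * (1ℚᵘ + P * (c * 0ℚᵘ + m * 0ℚᵘ - a * 0ℚᵘ))
    x≃x*1+P[c0+m0-a0] = solve-∀ ℚᵘ-ring
  expansion-d≡0 a (suc b) c c≤a a<p 1+b<p = begin
    ι (a choose c)
      ≈⟨ ≃⇒≈ (ι[m*[1+s]]*invᵘ[1+s]≃ι[m] (a choose c) b) ⟨
    ι ((a choose c) ℕ.* suc b) * i
      ≈⟨ ≃⇒≈ (≃-trans (*-congʳ {i} (ι-* (a choose c) (suc b))) (*-assoc (ι (a choose c)) (ι (suc b)) i)) ⟩
    ι (a choose c) * (ι (suc b) * i)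
      ≈⟨ ≈-step {m = a} {m′ = a ∸ c} 1+b<p 1+b<p (Integral-harmonicTerm a c z≤n b<p)
           ([ap+b+1]C[cp]*[[a∸c]p+b+1]≡[ap+b]C[cp]*[ap+b+1] p b c≤a)
           (expansion-d≡0 a b c c≤a a<p b<p) ⟩
    ι X′ * 1+p· (harmonicTerm a b c 0 + ι (a ∸ c) * i - ι a * i)
      ≈⟨ ≃⇒≈ (*-congˡ {ι X′} (1+p·-cong (shift-b (ι c) (Hᵘ 0) (ι (a ∸ c)) (Hᵘ b) (ι a) i))) ⟩
    ι X′ * 1+p· harmonicTerm a (suc b) c 0        ∎
    where
    open SetoidReasoning ≈-setoid
    b<p : b < p
    b<p = ℕ.<-trans (ℕ.n<1+n b) 1+b<p
    i : ℚᵘ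
    i = invᵘ (suc b)
    X′ : ℕ
    X′ = (a ℕ.* p ℕ.+ suc b) choose (c ℕ.* p)
    shift-b : ∀ c h m H a i → c * h + m * H - a * H + m * i - a * i ≃ c * h + m * (H + i) - a * (H + i)
    shift-b = solve-∀ ℚᵘ-ring

  expansion : ∀ a b c d → c ≤ a → a < p → d ≤ b → b < p →
    ι ((a choose c) ℕ.* (b choose d)) ≈ ι ((a ℕ.* p ℕ.+ b) choose (c ℕ.* p ℕ.+ d)) * 1+p· harmonicTerm a b c d
  expansion a b c zero c≤a a<p _ b<p = begin
    ι ((a choose c) ℕ.* (b choose 0))
      ≡⟨ cong ι (trans (cong ((a choose c) ℕ.*_) (nC0≡1 b)) (ℕ.*-identityʳ (a choose c))) ⟩
    ι (a choose c)
      ≈⟨ expansion-d≡0 a b c c≤a a<p b<p ⟩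
    ι ((a ℕ.* p ℕ.+ b) choose (c ℕ.* p)) * 1+p· harmonicTerm a b c 0
      ≡⟨ cong (λ k → ι ((a ℕ.* p ℕ.+ b) choose k) * 1+p· harmonicTerm a b c 0)
              (ℕ.+-identityʳ (c ℕ.* p)) ⟨
    ι ((a ℕ.* p ℕ.+ b) choose (c ℕ.* p ℕ.+ 0)) * 1+p· harmonicTerm a b c 0 ∎
    where open SetoidReasoning ≈-setoid
  expansion a b c (suc d) c≤a a<p d<b b<p = begin
    ι (A ℕ.* B′)
      ≈⟨ ≃⇒≈ (ι[m*[1+s]]*invᵘ[1+s]≃ι[m] (A ℕ.* B′) d) ⟨
    ι (A ℕ.* B′ ℕ.* suc d) * iᵈ
      ≡⟨ cong (λ n → ι n * iᵈ) AB′[1+d]≡AB[1+t] ⟩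
    ι (A ℕ.* B ℕ.* suc t) * iᵈ
      ≈⟨ ≃⇒≈ (≃-trans (*-congʳ {iᵈ} (ι-* (A ℕ.* B) (suc t))) (*-assoc (ι (A ℕ.* B)) (ι (suc t)) iᵈ)) ⟩
    ι (A ℕ.* B) * (ι (suc t) * iᵈ)
      ≈⟨ ≈-step {m = a ∸ c} {m′ = c} 1+d<p 1+t<p (Integral-harmonicTerm a c (ℕ.<⇒≤ d<b) b<p) X′-eq
           (expansion a b c d c≤a a<p (ℕ.<⇒≤ d<b) b<p) ⟩
    ι X′ * 1+p· (harmonicTerm a b c d + ι c * iᵈ - ι (a ∸ c) * iᵗ)
      ≈⟨ ≃⇒≈ (*-congˡ {ι X′} (1+p·-cong shift-d)) ⟩
    ι X′ * 1+p· harmonicTerm a b c (suc d) ∎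
    where
    open SetoidReasoning ≈-setoid
    t : ℕ
    t = b ∸ suc d
    b∸d≡1+t : b ∸ d ≡ suc t
    b∸d≡1+t = ℕ.+-∸-assoc 1 d<b
    1+d<p : suc d < p
    1+d<p = ℕ.≤-<-trans d<b b<p
    1+t<p : suc t < p
    1+t<p = subst (_< p) b∸d≡1+t (ℕ.≤-<-trans (ℕ.m∸n≤m b d) b<p)
    iᵈ iᵗ : ℚᵘ
    iᵈ = invᵘ (suc d)
    iᵗ = invᵘ (suc t)
    A B B′ X X′ : ℕ
    A = a choose c
    B = b choose d
    B′ = b choose suc d
    X = (a ℕ.* p ℕ.+ b) choose (c ℕ.* p ℕ.+ d)
    X′ = (a ℕ.* p ℕ.+ b) choose (c ℕ.* p ℕ.+ suc d)
    X′-eq : X′ ℕ.* (c ℕ.* p ℕ.+ suc d) ≡ X ℕ.* ((a ∸ c) ℕ.* p ℕ.+ suc t)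
    X′-eq = trans ([ap+b]C[cp+d+1]*[cp+d+1]≡[ap+b]C[cp+d]*[[a∸c]p+[b∸d]] p c≤a (ℕ.<⇒≤ d<b))
                  (cong (λ x → X ℕ.* ((a ∸ c) ℕ.* p ℕ.+ x)) b∸d≡1+t)
    AB′[1+d]≡AB[1+t] : A ℕ.* B′ ℕ.* suc d ≡ A ℕ.* B ℕ.* suc t
    AB′[1+d]≡AB[1+t] =
      trans (ℕ.*-assoc A B′ (suc d))
            (trans (cong (A ℕ.*_) (trans (nC[k+1]*[k+1]≡nCk*[n∸k] b d) (cong (B ℕ.*_) b∸d≡1+t)))
                   (sym (ℕ.*-assoc A B (suc t))))
    shift-d : harmonicTerm a b c d + ι c * iᵈ - ι (a ∸ c) * iᵗ ≃ harmonicTerm a b c (suc d)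
    shift-d = ≃-trans (+-congˡ (- (ι (a ∸ c) * iᵗ)) (+-congˡ (ι c * iᵈ) (≃-reflexive
                (cong (λ k → ι c * Hᵘ d + ι (a ∸ c) * Hᵘ k - ι a * Hᵘ b) b∸d≡1+t))))
                (regroup (ι c) (Hᵘ d) iᵈ (ι (a ∸ c)) (Hᵘ t) iᵗ (ι a) (Hᵘ b))
      where
      regroup : ∀ C h i M H j A K → C * h + M * (H + j) - A * K + C * i - M * j ≃ C * (h + i) + M * H - A * K
      regroup = solve-∀ ℚᵘ-ring

  ≈-∤ : ∀ {n m w} → ¬ p ∣ n → Integral w → ι n ≈ ι m * w → ¬ p ∣ m
  ≈-∤ {n} {m} {w} p∤n w-int (≈-intro p²∣n-mw) (divides k refl) =
    p∤n (subst (_∣ n) (ℕ.*-identityʳ p) (∣⇒∣↥ p∣n))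
    where
    kp·w : ι p * (ι k * w) ≃ ι (k ℕ.* p) * w
    kp·w = ≃-trans (swap (ι p) (ι k) w) (*-congʳ {w} (≃-sym (ι-* k p)))
      where
      swap : ∀ P a b → P * (a * b) ≃ a * P * b
      swap = solve-∀ ℚᵘ-ring
    recombine : ∀ x y → x - y + y ≃ x
    recombine = solve-∀ ℚᵘ-ring
    p∣n : p^ 1 ∣ ι n
    p∣n = ∣-resp-≃ (recombine (ι n) (ι (k ℕ.* p) * w))
            (∣-+ (∣-weaken p²∣n-mw) (∣-resp-≃ kp·w (∣-ι[p]* (∣-integral (Integral-* (Integral-ι k) w-int)))))

  ≈-invert : ∀ {X a b e} → ¬ p ∣ a → ¬ p ∣ b → Integral e → ι (a ℕ.* b) ≈ ι X * 1+p· e →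
             invᵘ X - invᵘ a * invᵘ b ≈ ι p * invᵘ a * invᵘ b * e
  ≈-invert {X} {zero} p∤0 _ _ _ = contradiction (p ∣0) p∤0
  ≈-invert {X} {suc a} {zero} _ p∤0 _ _ = contradiction (p ∣0) p∤0
  ≈-invert {zero} {suc a} {suc b} p∤a p∤b e-int ab≈X·e =
    contradiction (p ∣0) (≈-∤ (p∤* p∤a p∤b) (Integral-1+p· e-int) ab≈X·e)
  ≈-invert {suc X} {suc a} {suc b} {e} p∤a p∤b e-int ab≈X·e = begin
    iX - ia * ib                          ≈⟨ ≈-+ (≈-trans iX≈ (≃⇒≈ X-cancels)) (≈-refl { - (ia * ib)}) ⟩
    ia * ib * 1+p· e - ia * ib            ≈⟨ ≃⇒≈ (expand ia ib (ι p) e) ⟩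
    ι p * ia * ib * e                     ∎
    where
    open SetoidReasoning ≈-setoid
    iX ia ib w : ℚᵘ
    iX = invᵘ (suc X)
    ia = invᵘ (suc a)
    ib = invᵘ (suc b)
    w = iX * (ia * ib)
    w-int : Integral w
    w-int = Integral-* (Integral-invᵘ (≈-∤ (p∤* p∤a p∤b) (Integral-1+p· e-int) ab≈X·e))
                       (Integral-* (Integral-invᵘ p∤a) (Integral-invᵘ p∤b))
    regroup₁ : ∀ x y z u v → x * (y * z) * (u * v) ≃ x * ((u * y) * (v * z))
    regroup₁ = solve-∀ ℚᵘ-ring
    regroup₂ : ∀ x y z u v → x * (y * z) * (u * v) ≃ u * x * (y * z * v)
    regroup₂ = solve-∀ ℚᵘ-ring
    expand : ∀ x y P e → x * y * (1ℚᵘ + P * e) - x * y ≃ P * x * y * e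
    expand = solve-∀ ℚᵘ-ring
    x*[1*1]≃x : ∀ x → x * (1ℚᵘ * 1ℚᵘ) ≃ x
    x*[1*1]≃x = solve-∀ ℚᵘ-ring
    iX≈ : iX ≈ w * (ι (suc X) * 1+p· e)
    iX≈ = begin
      iX
        ≈⟨ ≃⇒≈ (x*[1*1]≃x iX) ⟨
      iX * (1ℚᵘ * 1ℚᵘ)
        ≈⟨ ≃⇒≈ (*-congˡ {iX} (*-cong (ι[1+n]*invᵘ[1+n]≃1 a) (ι[1+n]*invᵘ[1+n]≃1 b))) ⟨
      iX * ((ι (suc a) * ia) * (ι (suc b) * ib))
        ≈⟨ ≃⇒≈ (regroup₁ iX ia ib (ι (suc a)) (ι (suc b))) ⟨
      w * (ι (suc a) * ι (suc b))
        ≈⟨ ≃⇒≈ (*-congˡ {w} (ι-* (suc a) (suc b))) ⟨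
      w * ι (suc a ℕ.* suc b)
        ≈⟨ ≈-*ˡ w-int ab≈X·e ⟩
      w * (ι (suc X) * 1+p· e) ∎
    X-cancels : w * (ι (suc X) * 1+p· e) ≃ ia * ib * 1+p· e
    X-cancels = ≃-trans (regroup₂ iX ia ib (ι (suc X)) (1+p· e))
                  (≃-trans (*-congʳ {ia * ib * 1+p· e} (ι[1+n]*invᵘ[1+n]≃1 X))
                           (*-identityˡ (ia * ib * 1+p· e)))

  νp≥2-fromℚᵘ : ∀ q → p^ 2 ∣ ℚ.toℚᵘ q → νp≥2 p q
  νp≥2-fromℚᵘ (ℚ.mkℚ n d coprime) p²∣q = p²∣n , p∤1+d
    where
    p²∣n : p ^ 2 ∣ ℤ.∣ n ∣
    p²∣n = ∣⇒∣↥ p²∣q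
    p∤1+d : ¬ p ∣ suc d
    p∤1+d p∣1+d = p∤1 (subst (p ∣_) (recompute coprime (∣-trans (m∣m*n (p ^ 1)) p²∣n , p∣1+d)) ∣-refl)

open import Defs
open import Data.Nat as ℕ using (ℕ; _≤_; _<_; _∸_)
open import Data.Nat.Combinatorics using () renaming (_C_ to _choose_)
open import Data.Nat.Primality using (Prime)
open import Data.Integer using (+_)
open import Data.Rational using (_+_; _-_; _*_; _/_)
import Data.Rational.Base as ℚ
import Data.Rational.Unnormalised.Base as ℚᵘ
open import Data.Rational.Unnormalised.Base using (_≃_)
open import Data.Rational.Unnormalised.Properties using (≃-sym)
open import Data.Sum.Base using (inj₂)

lemma5p2 : (p A B C D : ℕ) → Prime p → C ≤ A → A < p → D ≤ B → B < p →
    (invℕ ((A ℕ.* p ℕ.+ B) choose (C ℕ.* p ℕ.+ D)) - invℕ (A choose C) * invℕ (B choose D))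
      ≡ ((+ p / 1) * invℕ (A choose C) * invℕ (B choose D)
          * ((+ C / 1) * H D + (+ (A ∸ C) / 1) * H (B ∸ D) - (+ A / 1) * H B))
      [mod p ²]
lemma5p2 p A B C D p-prime C≤A A<p D≤B B<p = inj₂ (νp≥2-fromℚᵘ _ (∣-resp-≃ (≃-sym toℚᵘ-difference) p²∣difference))
  where
  open Unnormalised
  open Localisation p-prime
  a b X : ℕ
  a = A choose C
  b = B choose D
  X = (A ℕ.* p ℕ.+ B) choose (C ℕ.* p ℕ.+ D)
  E : ℚ.ℚ
  E = (+ C / 1) * H D + (+ (A ∸ C) / 1) * H (B ∸ D) - (+ A / 1) * H B
  e : ℚᵘ.ℚᵘ
  e = harmonicTerm A B C D
  expanded : ι (a ℕ.* b) ≈ ι X ℚᵘ.* 1+p· e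
  expanded = expansion A B C D C≤A A<p D≤B B<p
  p²∣difference : p^ 2 ∣ (invᵘ X ℚᵘ.- invᵘ a ℚᵘ.* invᵘ b) ℚᵘ.- ι p ℚᵘ.* invᵘ a ℚᵘ.* invᵘ b ℚᵘ.* e
  p²∣difference = _≈_.p²∣x-y (≈-invert (p∤nCk C≤A A<p) (p∤nCk D≤B B<p) (Integral-harmonicTerm A C D≤B B<p) expanded)
  toℚᵘ-difference : ℚ.toℚᵘ ((invℕ X - invℕ a * invℕ b) - (+ p / 1) * invℕ a * invℕ b * E)
                  ≃ (invᵘ X ℚᵘ.- invᵘ a ℚᵘ.* invᵘ b) ℚᵘ.- ι p ℚᵘ.* invᵘ a ℚᵘ.* invᵘ b ℚᵘ.* e
  toℚᵘ-difference = toℚᵘ-[1/X-1/ab]-[p/ab]e p X a b E (toℚᵘ-harmonicTerm A B C D)
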